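{- Let $B=\{1,2,3,4,5,6\}\in\triangle_3$. For every partition $B=X\cup Y$ with $X\cap Y=\emptyset$, there exists $Z\in\triangle_2(B)$ with $Z\subseteq X$ or $Z\subseteq Y$. (That is, the game Mines$_3$ never ends in a draw.)
   Context: $T_n=n(n+1)/2$, $T_0=0$. A finite set $X\subseteq\mathbb{N}$ with $|X|=T_n$, enumerated $x_1<\dots<x_{T_n}$, has $i$-th level $\{x_{T_{i-1}+1},\dots,x_{T_i}\}$ for $1\le i\le n$; $\triangle_n$ is the set of all $X\subseteq\mathbb{N}$ with $|X|=T_n$. For such sets $X,Y$, $X\le Y$ means $X\subseteq Y$ and every level of $X$ is contained in a single level of $Y$, distinct levels of $X$ being contained in distinct levels of $Y$. $\triangle_k(B)=\{Z\in\triangle_k: Z\le B\}$. In the game Mines$_3$, two players alternately mark positions of $B$; $X$ and $Y$ are the sets of positions marked by players one and two. -}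

module Defs where

open import Data.Nat using (ℕ; zero; suc; _+_; _*_; _<_)
open import Data.Nat.Properties using (_<?_)
open import Data.List using (List; []; _∷_; length; take; drop)
open import Data.List.Relation.Unary.Linked using (Linked)
open import Data.List.Relation.Unary.All using (All)
open import Data.List.Membership.Propositional using (_∈_)
open import Data.List.Relation.Binary.Subset.Propositional using (_⊆_)
open import Data.Fin using (Fin; toℕ)
open import Data.Product using (Σ; _×_; ∃; _,_; proj₁)
open import Function.Definitions using (Injective)
open import Relation.Binary.PropositionalEquality using (_≡_; refl)

T : ℕ → ℕ
T zero    = 0
T (suc n) = T n + suc n

-- A finite set X ⊆ ℕ is represented by its increasing enumeration x₁ < x₂ < …
Increasing : List ℕ → Set
Increasing = Linked _<_

record △ (n : ℕ) : Set where
  constructor mk△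
  field
    elems      : List ℕ
    increasing : Increasing elems
    size       : length elems ≡ T n
open △ public

-- The (j+1)-th level (j : Fin n, 0-based): x_{T j + 1}, …, x_{T (j+1)}
level : List ℕ → ℕ → List ℕ
level xs j = take (suc j) (drop (T j) xs)

_≤△_ : ∀ {m n} → △ m → △ n → Set
_≤△_ {m} {n} (mk△ X _ _) (mk△ Y _ _) =
  (X ⊆ Y) ×
  ∃ λ (f : Fin m → Fin n) →
    Injective _≡_ _≡_ f × (∀ i → level X (toℕ i) ⊆ level Y (toℕ (f i)))

△[_]_ : ∀ {n} → (k : ℕ) → △ n → Set
△[_]_ {n} k B = Σ (△ k) (λ Z → _≤△_ {k} {n} Z B)

B₆ : △ 3
B₆ = mk△ (1 ∷ 2 ∷ 3 ∷ 4 ∷ 5 ∷ 6 ∷ []) lk refl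
  where
  open Data.List.Relation.Unary.Linked using ([]; [-]; _∷_)
  open import Data.Nat using (s≤s; z≤n)
  lk : Increasing (1 ∷ 2 ∷ 3 ∷ 4 ∷ 5 ∷ 6 ∷ [])
  lk = s≤s (s≤s z≤n) ∷ s≤s (s≤s (s≤s z≤n)) ∷ s≤s (s≤s (s≤s (s≤s z≤n)))
     ∷ s≤s (s≤s (s≤s (s≤s (s≤s z≤n)))) ∷ s≤s (s≤s (s≤s (s≤s (s≤s (s≤s z≤n))))) ∷ [-]

-- The levels of B₆ are {1}, {2,3}, {4,5,6}, and any point of one level together
-- with two points of another level forms a member of △₂(B₆). By pigeonhole two of
-- 4, 5, 6 get the same colour; if some point of {1,2,3} also has that colour it
-- completes them, and otherwise {1,2,3} is monochromatic in the other colour.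
module Submission where

open import Defs
open import Data.Nat using (ℕ; suc; _<_; _≤_)
open import Data.Nat.Properties using (<-≤-trans; _≟_; _<?_; _≤?_)
open import Data.Fin using (Fin; zero; suc; toℕ)
open import Data.List using (List; []; _∷_; drop)
open import Data.List.Relation.Unary.All using (All; []; _∷_)
open import Data.List.Relation.Unary.Any using (here; there)
open import Data.List.Relation.Unary.Linked using ([-]; _∷_)
open import Data.List.Membership.Propositional using (_∈_)
open import Data.List.Membership.DecPropositional _≟_ using (_∈?_)
open import Data.List.Relation.Binary.Subset.Propositional using (_⊆_)
open import Data.List.Relation.Binary.Sublist.Propositional.Properties
  using (Any-resp-⊆; take-⊆; drop-⊆)
open import Data.List.Relation.Binary.Sublist.Propositional using (⊆-trans)
open import Data.Product using (Σ; ∃₂; _×_; _,_; proj₁; map₂)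
open import Data.Sum using (_⊎_; inj₁; inj₂; swap)
open import Data.Empty using (⊥)
open import Function.Bundles using (_⇔_; Equivalence)
open import Function.Definitions using (Injective)
open import Relation.Nullary using (¬_; contradiction)
open import Relation.Nullary.Decidable using (True; toWitness; from-yes)
open import Relation.Binary.PropositionalEquality using (_≡_; refl; sym)

level-⊆ : ∀ xs j → level xs j ⊆ xs
level-⊆ xs j = Any-resp-⊆ (⊆-trans (take-⊆ (suc j) (drop (T j) xs)) (drop-⊆ (T j) xs))

module _ {n} (B : △ n) where

  private
    L : Fin n → List ℕ
    L i = level (elems B) (toℕ i)

  pointAndPair : ∀ {a u v} (i j : Fin n) → ¬ i ≡ j → a < u → u < v →
                 a ∈ L i → u ∈ L j → v ∈ L j → △[ 2 ] B
  pointAndPair {a} {u} {v} i j i≢j a<u u<v a∈i u∈j v∈j =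
    mk△ (a ∷ u ∷ v ∷ []) (a<u ∷ u<v ∷ [-]) refl ,
    Z⊆B , f , f-injective , levels-⊆
    where
    f : Fin 2 → Fin n
    f zero       = i
    f (suc zero) = j

    f-injective : Injective _≡_ _≡_ f
    f-injective {zero}     {zero}     _   = refl
    f-injective {zero}     {suc zero} i≡j = contradiction i≡j i≢j
    f-injective {suc zero} {zero}     j≡i = contradiction (sym j≡i) i≢j
    f-injective {suc zero} {suc zero} _   = refl

    levels-⊆ : ∀ k → level (a ∷ u ∷ v ∷ []) (toℕ k) ⊆ L (f k)
    levels-⊆ zero       (here refl)         = a∈i
    levels-⊆ (suc zero) (here refl)         = u∈j
    levels-⊆ (suc zero) (there (here refl)) = v∈j

    Z⊆B : a ∷ u ∷ v ∷ [] ⊆ elems B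
    Z⊆B (here refl)                 = level-⊆ (elems B) (toℕ i) a∈i
    Z⊆B (there (here refl))         = level-⊆ (elems B) (toℕ j) u∈j
    Z⊆B (there (there (here refl))) = level-⊆ (elems B) (toℕ j) v∈j

Monochromatic : (P Q : ℕ → Set) → List ℕ → Set
Monochromatic P Q zs = All P zs ⊎ All Q zs

MonochromaticIn△₂B₆ : (P Q : ℕ → Set) → Set
MonochromaticIn△₂B₆ P Q = Σ (△[ 2 ] B₆) λ Z → Monochromatic P Q (elems (proj₁ Z))

data TopPair : ℕ → ℕ → Set where
  4-5 : TopPair 4 5
  4-6 : TopPair 4 6
  5-6 : TopPair 5 6

top : Fin 3
top = suc (suc zero)

module _ {u v : ℕ} where

  private
    topLevel : List ℕ
    topLevel = level (elems B₆) (toℕ top)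

  TopPair-≥4 : TopPair u v → 4 ≤ u
  TopPair-≥4 4-5 = from-yes (4 ≤? 4)
  TopPair-≥4 4-6 = from-yes (4 ≤? 4)
  TopPair-≥4 5-6 = from-yes (4 ≤? 5)

  TopPair-< : TopPair u v → u < v
  TopPair-< 4-5 = from-yes (4 <? 5)
  TopPair-< 4-6 = from-yes (4 <? 6)
  TopPair-< 5-6 = from-yes (5 <? 6)

  TopPair-∈ˡ : TopPair u v → u ∈ topLevel
  TopPair-∈ˡ 4-5 = here refl
  TopPair-∈ˡ 4-6 = here refl
  TopPair-∈ˡ 5-6 = there (here refl)

  TopPair-∈ʳ : TopPair u v → v ∈ topLevel
  TopPair-∈ʳ 4-5 = there (here refl)
  TopPair-∈ʳ 4-6 = there (there (here refl))
  TopPair-∈ʳ 5-6 = there (there (here refl))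

pointAndTopPair : ∀ {a u v} (i : Fin 3) → ¬ i ≡ top → a < 4 →
                  a ∈ level (elems B₆) (toℕ i) → TopPair u v → △[ 2 ] B₆
pointAndTopPair i i≢top a<4 a∈i t =
  pointAndPair B₆ i top i≢top (<-≤-trans a<4 (TopPair-≥4 t)) (TopPair-< t)
               a∈i (TopPair-∈ˡ t) (TopPair-∈ʳ t)

monochromaticTopPair : ∀ {P Q : ℕ → Set} → P 4 ⊎ Q 4 → P 5 ⊎ Q 5 → P 6 ⊎ Q 6 →
                       ∃₂ λ u v → TopPair u v × (P u × P v ⊎ Q u × Q v)
monochromaticTopPair (inj₁ p₄) (inj₁ p₅) _         = 4 , 5 , 4-5 , inj₁ (p₄ , p₅)
monochromaticTopPair (inj₁ p₄) _         (inj₁ p₆) = 4 , 6 , 4-6 , inj₁ (p₄ , p₆)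
monochromaticTopPair _         (inj₁ p₅) (inj₁ p₆) = 5 , 6 , 5-6 , inj₁ (p₅ , p₆)
monochromaticTopPair (inj₂ q₄) (inj₂ q₅) _         = 4 , 5 , 4-5 , inj₂ (q₄ , q₅)
monochromaticTopPair (inj₂ q₄) _         (inj₂ q₆) = 4 , 6 , 4-6 , inj₂ (q₄ , q₆)
monochromaticTopPair _         (inj₂ q₅) (inj₂ q₆) = 5 , 6 , 5-6 , inj₂ (q₅ , q₆)

completeTopPair : ∀ {P Q : ℕ → Set} {u v} → P 1 ⊎ Q 1 → P 2 ⊎ Q 2 → P 3 ⊎ Q 3 →
                  TopPair u v → P u → P v → MonochromaticIn△₂B₆ P Q
completeTopPair (inj₁ p₁) _ _ t pᵤ pᵥ =
  pointAndTopPair zero (λ ()) (from-yes (1 <? 4)) (here refl) t ,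
  inj₁ (p₁ ∷ pᵤ ∷ pᵥ ∷ [])
completeTopPair _ (inj₁ p₂) _ t pᵤ pᵥ =
  pointAndTopPair (suc zero) (λ ()) (from-yes (2 <? 4)) (here refl) t ,
  inj₁ (p₂ ∷ pᵤ ∷ pᵥ ∷ [])
completeTopPair _ _ (inj₁ p₃) t pᵤ pᵥ =
  pointAndTopPair (suc zero) (λ ()) (from-yes (3 <? 4)) (there (here refl)) t ,
  inj₁ (p₃ ∷ pᵤ ∷ pᵥ ∷ [])
completeTopPair (inj₂ q₁) (inj₂ q₂) (inj₂ q₃) _ _ _ =
  pointAndPair B₆ zero (suc zero) (λ ()) (from-yes (1 <? 2)) (from-yes (2 <? 3))
               (here refl) (here refl) (there (here refl)) ,
  inj₂ (q₁ ∷ q₂ ∷ q₃ ∷ [])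

theorem3 : (X Y : ℕ → Set) →
    (∀ b → (b ∈ elems B₆) ⇔ (X b ⊎ Y b)) →
    (∀ b → X b → Y b → ⊥) →
    Σ (△[ 2 ] B₆) (λ Z → All X (elems (proj₁ Z)) ⊎ All Y (elems (proj₁ Z)))
theorem3 X Y covers _ = fromTopPair (monochromaticTopPair (colour 4) (colour 5) (colour 6))
  where
  colour : ∀ b {b∈B₆ : True (b ∈? elems B₆)} → X b ⊎ Y b
  colour b {b∈B₆} = Equivalence.to (covers b) (toWitness b∈B₆)

  fromTopPair : (∃₂ λ u v → TopPair u v × (X u × X v ⊎ Y u × Y v)) → MonochromaticIn△₂B₆ X Y
  fromTopPair (_ , _ , t , inj₁ (xᵤ , xᵥ)) =
    completeTopPair (colour 1) (colour 2) (colour 3) t xᵤ xᵥ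
  fromTopPair (_ , _ , t , inj₂ (yᵤ , yᵥ)) =
    map₂ swap (completeTopPair (swap (colour 1)) (swap (colour 2)) (swap (colour 3)) t yᵤ yᵥ)
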